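{- Let $k\ge 1$ and let $\mathbf{A},\mathbf{B}$ be finite relational structures over the same signature. In the existential $k$-cover game on $\mathbf{A},\mathbf{B}$, the Duplicator has a winning strategy if and only if the Duplicator has a compact winning strategy.
   Context: A relational structure $\mathbf{A}$ has a finite universe $A$ and relations $R^{\mathbf{A}}\subseteq A^r$ for each relation symbol $R$ (arity $r$) of a finite signature. The hypergraph $H(\mathbf{A})$ has vertex set $A$ and a hyperedge $\{a_1,\ldots,a_r\}$ for each tuple $(a_1,\ldots,a_r)$ in any relation of $\mathbf{A}$. A $k$-union over $\mathbf{A}$ is a union of $k$ hyperedges of $H(\mathbf{A})$ (the empty set is the unique $0$-union). The weight of $X\subseteq A$ is the least $k\ge 0$ such that $X\cap\bigcup_e e$ is contained in a $k$-union. A projective homomorphism from $\mathbf{A}$ to $\mathbf{B}$ is a partial function $h$ from $A$ to $B$ such that for every $R$ and every $(a_1,\ldots,a_r)\in R^{\mathbf{A}}$ there exists $(b_1,\ldots,b_r)\in R^{\mathbf{B}}$ with $h(a_i)=b_i$ for all $a_i\in\mathsf{dom}(h)$. A winning strategy for the Duplicator in the existential $k$-cover game on $\mathbf{A},\mathbf{B}$ is a non-empty set $H$ of projective homomorphisms from $\mathbf{A}$ to $\mathbf{B}$ such that (1) for every $h\in H$ and $a\in A\setminus\mathsf{dom}(h)$ with $\mathsf{dom}(h)\cup\{a\}$ of weight $\le k$, there is $h'\in H$ extending $h$ with $\mathsf{dom}(h')=\mathsf{dom}(h)\cup\{a\}$; (2) $H$ is closed under subfunctions. A compact winning strategy is a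 non-empty set $H$ of projective homomorphisms from $\mathbf{A}$ to $\mathbf{B}$ such that (1) for all $h\in H$, $\mathsf{dom}(h)$ is a $k$-union over $\mathbf{A}$; (2) for every $h\in H$ and every $k$-union $U$ over $\mathbf{A}$, there is $h'\in H$ with $\mathsf{dom}(h')=U$ and $h(v)=h'(v)$ for all $v\in\mathsf{dom}(h)\cap\mathsf{dom}(h')$. -}

module Defs where

open import Data.Nat using (ℕ; _≤_; _>_)
open import Data.Fin using (Fin)
open import Data.Vec using (Vec; lookup; toList)
open import Data.List using (List; length)
open import Data.List.Membership.Propositional using (_∈_)
open import Data.List.Relation.Unary.Any using (Any)
open import Data.Maybe using (Maybe; just; Is-just)
open import Data.Product using (Σ; ∃; _×_; _,_; proj₁)
open import Data.Sum using (_⊎_)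
open import Relation.Binary.PropositionalEquality using (_≡_)
open import Relation.Nullary using (¬_)

record Signature : Set where
  field
    nsym  : ℕ
    arity : Fin nsym → ℕ
open Signature public

record Structure (σ : Signature) : Set where
  field
    size : ℕ
    rel  : (R : Fin (nsym σ)) → List (Vec (Fin size) (arity σ R))
open Structure public

module _ {σ : Signature} (A : Structure σ) where

  Elt : Set
  Elt = Fin (size A)

  Subset : Set₁
  Subset = Elt → Set

  -- a hyperedge of H(A): given by a tuple of some relation of A
  Hyperedge : Set
  Hyperedge = Σ (Fin (nsym σ)) λ R → Σ (Vec Elt (arity σ R)) λ t → t ∈ rel A R

  _∈ₑ_ : Elt → Hyperedge → Set
  a ∈ₑ (R , t , _) = a ∈ toList t

  _∈ᵤ_ : Elt → List Hyperedge → Set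
  a ∈ᵤ es = Any (a ∈ₑ_) es

  InSomeEdge : Elt → Set
  InSomeEdge a = Σ Hyperedge λ e → a ∈ₑ e

  KUnion : ℕ → Set
  KUnion k = Σ (List Hyperedge) λ es → length es ≤ k

  WeightLE : Subset → ℕ → Set
  WeightLE X k = Σ (KUnion k) λ { (es , _) → ∀ a → X a → InSomeEdge a → a ∈ᵤ es }

PFun : {σ : Signature} → Structure σ → Structure σ → Set
PFun A B = Elt A → Maybe (Elt B)

module _ {σ : Signature} {A B : Structure σ} where

  dom : PFun A B → Elt A → Set
  dom h a = Is-just (h a)

  _⊑_ : PFun A B → PFun A B → Set
  g ⊑ h = ∀ a b → g a ≡ just b → h a ≡ just b

  IsProjHom : PFun A B → Set
  IsProjHom h =
    ∀ (R : Fin (nsym σ)) (t : Vec (Elt A) (arity σ R)) → t ∈ rel A R →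
      Σ (Vec (Elt B) (arity σ R)) λ t' → t' ∈ rel B R ×
        (∀ i b → h (lookup t i) ≡ just b → lookup t' i ≡ b)

  DomIs : PFun A B → List (Hyperedge A) → Set
  DomIs h es = ∀ x → (dom h x → _∈ᵤ_ A x es) × (_∈ᵤ_ A x es → dom h x)

  IsWinningStrategy : ℕ → (PFun A B → Set) → Set
  IsWinningStrategy k H =
    (∀ h → H h → IsProjHom h) ×
    (∃ λ h → H h) ×
    (∀ h → H h → ∀ a → ¬ dom h a →
       WeightLE A (λ x → dom h x ⊎ x ≡ a) k →
       Σ (PFun A B) λ h' → H h' × h ⊑ h' ×
         (∀ x → (dom h' x → dom h x ⊎ x ≡ a) × (dom h x ⊎ x ≡ a → dom h' x))) ×
    (∀ h g → H h → g ⊑ h → H g)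

  IsCompactStrategy : ℕ → (PFun A B → Set) → Set
  IsCompactStrategy k H =
    (∀ h → H h → IsProjHom h) ×
    (∃ λ h → H h) ×
    (∀ h → H h → Σ (KUnion A k) λ U → DomIs h (proj₁ U)) ×
    (∀ h → H h → (U : KUnion A k) →
       Σ (PFun A B) λ h' → H h' × DomIs h' (proj₁ U) ×
         (∀ v b b' → h v ≡ just b → h' v ≡ just b' → b ≡ b'))

  HasWinningStrategy : ℕ → Set₁
  HasWinningStrategy k = Σ (PFun A B → Set) λ H → IsWinningStrategy k H

  HasCompactStrategy : ℕ → Set₁
  HasCompactStrategy k = Σ (PFun A B → Set) λ H → IsCompactStrategy k H

-- A compact strategy H yields a winning one: take every partial map that agrees,
-- on the vertices covered by hyperedges, with some member of H.  To add a vertex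
-- a to such a map g (witnessed by h ∈ H), cover dom g ∪ {a} by a k-union U and
-- jump to the member of H on U that is consistent with h.  Conversely, the
-- members of a winning strategy whose domain is a k-union form a compact
-- strategy: restrict h to a given k-union U (subfunction closure) and then add
-- the missing vertices of U one at a time, which is always allowed because the
-- domain stays inside U and hence has weight at most k.
module Submission where

open import Data.Empty using (⊥-elim)
open import Data.Fin using (_≟_; fromℕ<)
open import Data.List using (List; []; _∷_; allFin)
open import Data.List.Membership.Propositional using (_∈_)
open import Data.List.Membership.Propositional.Properties using (∈-allFin)
import Data.List.Membership.DecPropositional as DecMembership
open import Data.List.Relation.Unary.Any using (here; there; any?)
open import Data.Maybe using (Maybe; just; nothing; Is-just; fromMaybe)
open import Data.Maybe.Properties using (just-injective)
import Data.Maybe.Relation.Unary.Any as Maybe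
open import Data.Nat using (ℕ; _≥_; _>_; z≤n)
open import Data.Product using (Σ; ∃; _×_; _,_; proj₁; proj₂)
open import Data.Sum using (_⊎_; inj₁; inj₂; [_,_])
open import Data.Unit using (tt)
open import Data.Vec using (toList; lookup)
open import Data.Vec.Membership.Propositional.Properties using (∈-lookup; ∈-toList⁺)
open import Relation.Binary.PropositionalEquality using (_≡_; refl; sym; trans; cong)
open import Relation.Nullary using (¬_; Dec; yes; no)
open import Relation.Unary using (_⊆′_)

open import Defs hiding (dom; _⊑_; IsProjHom; DomIs)
import Defs

private variable
  X : Set

Is-just⇒≡just : {m : Maybe X} → Is-just m → ∃ λ x → m ≡ just x
Is-just⇒≡just (Maybe.just _) = _ , refl

≡just⇒Is-just : {m : Maybe X} {x : X} → m ≡ just x → Is-just m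
≡just⇒Is-just refl = Maybe.just tt

-- These notions take A and B implicitly, but A and B cannot be inferred
-- from a PFun A B, so they are redefined here with A and B fixed.
module _ {σ : Signature} (A B : Structure σ) where

  dom : PFun A B → Subset A
  dom = Defs.dom {A = A} {B = B}

  _⊑_ : PFun A B → PFun A B → Set
  _⊑_ = Defs._⊑_ {A = A} {B = B}

  IsProjHom : PFun A B → Set
  IsProjHom = Defs.IsProjHom {A = A} {B = B}

  DomIs : PFun A B → List (Hyperedge A) → Set
  DomIs = Defs.DomIs {A = A} {B = B}

  ⋃ : List (Hyperedge A) → Subset A
  ⋃ es x = _∈ᵤ_ A x es

  ⋃? : (es : List (Hyperedge A)) (x : Elt A) → Dec (⋃ es x)
  ⋃? es x = any? (λ { (_ , t , _) → DecMembership._∈?_ _≟_ x (toList t) }) es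

  dom? : ∀ g x → Dec (dom g x)
  dom? g x = Maybe.dec (λ _ → yes tt) (g x)

  _⊑ₑ_ : PFun A B → PFun A B → Set
  g ⊑ₑ h = ∀ a b → InSomeEdge A a → g a ≡ just b → h a ≡ just b

  Consistent : PFun A B → PFun A B → Set
  Consistent g h = ∀ v b b′ → g v ≡ just b → h v ≡ just b′ → b ≡ b′

  private variable
    f g h h′ : PFun A B
    a x : Elt A
    b : Elt B
    es : List (Hyperedge A)

  ⊑-refl : g ⊑ g
  ⊑-refl _ _ eq = eq

  ⊑-trans : f ⊑ g → g ⊑ h → f ⊑ h
  ⊑-trans f⊑g g⊑h a b eq = g⊑h a b (f⊑g a b eq)

  ⊑⇒dom⊆ : g ⊑ h → dom g ⊆′ dom h
  ⊑⇒dom⊆ g⊑h x x∈dom with Is-just⇒≡just x∈dom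
  ... | _ , eq = ≡just⇒Is-just (g⊑h x _ eq)

  ⊑ₑ-refl : g ⊑ₑ g
  ⊑ₑ-refl _ _ _ eq = eq

  ⊑-⊑ₑ-trans : f ⊑ g → g ⊑ₑ h → f ⊑ₑ h
  ⊑-⊑ₑ-trans f⊑g g⊑ₑh a b a∈e eq = g⊑ₑh a b a∈e (f⊑g a b eq)

  -- Every entry of a tuple of a relation lies in a hyperedge, so only those
  -- vertices matter for projective homomorphisms.
  ⊑ₑ-isProjHom : g ⊑ₑ h → IsProjHom h → IsProjHom g
  ⊑ₑ-isProjHom g⊑ₑh h-hom R t t∈R with h-hom R t t∈R
  ... | t′ , t′∈R , agree = t′ , t′∈R , λ i b eq →
    agree i b (g⊑ₑh (lookup t i) b ((R , t , t∈R) , ∈-toList⁺ (∈-lookup i t)) eq)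

  consistent-⊑ : Consistent h h′ → h x ≡ just b → dom h′ x → h′ x ≡ just b
  consistent-⊑ {x = x} cons hx≡b x∈dom with Is-just⇒≡just x∈dom
  ... | b′ , h′x≡b′ = trans h′x≡b′ (cong just (sym (cons x _ b′ hx≡b h′x≡b′)))

  insert : Elt A → Elt B → PFun A B → PFun A B
  insert a c g x with x ≟ a
  ... | yes _ = just c
  ... | no _ = g x

  ⊑-insert : ∀ {c} → ¬ dom g a → g ⊑ insert a c g
  ⊑-insert {a = a} a∉dom x b eq with x ≟ a
  ... | yes refl = ⊥-elim (a∉dom (≡just⇒Is-just eq))
  ... | no _ = eq

  dom-insert : ∀ {c} x → (dom (insert a c g) x → dom g x ⊎ x ≡ a)
                       × (dom g x ⊎ x ≡ a → dom (insert a c g) x)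
  dom-insert {a = a} x with x ≟ a
  ... | yes x≡a = (λ _ → inj₂ x≡a) , λ _ → Maybe.just tt
  ... | no x≢a = inj₁ , [ (λ x∈dom → x∈dom) , (λ x≡a → ⊥-elim (x≢a x≡a)) ]

  -- Vertices in no hyperedge need not lie in a k-union; they are sent to b₀.
  insert-⊑ₑ : ∀ b₀ → g ⊑ₑ h → Consistent h h′ →
              (∀ x → dom g x ⊎ x ≡ a → InSomeEdge A x → dom h′ x) →
              insert a (fromMaybe b₀ (h′ a)) g ⊑ₑ h′
  insert-⊑ₑ {h′ = h′} {a = a} b₀ g⊑ₑh cons covered x b x∈e eq with x ≟ a
  ... | no _ = consistent-⊑ cons (g⊑ₑh x b x∈e eq) (covered x (inj₁ (≡just⇒Is-just eq)) x∈e)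
  ... | yes refl with h′ x | covered x (inj₂ refl) x∈e
  ...   | just _ | _ = eq

  EdgeDownset : (PFun A B → Set) → PFun A B → Set
  EdgeDownset H g = ∃ λ h → H h × g ⊑ₑ h

  module _ {k : ℕ} {H : PFun A B → Set} where

    EdgeDownset-extend : IsCompactStrategy {A = A} {B = B} k H → Elt B →
      ∀ g → EdgeDownset H g → ∀ a → ¬ dom g a →
      WeightLE A (λ x → dom g x ⊎ x ≡ a) k →
      Σ (PFun A B) λ g′ → EdgeDownset H g′ × g ⊑ g′ ×
        (∀ x → (dom g′ x → dom g x ⊎ x ≡ a) × (dom g x ⊎ x ≡ a → dom g′ x))
    EdgeDownset-extend (_ , _ , _ , cover) b₀ g (h , h∈H , g⊑ₑh) a a∉dom (U , U-covers)
      with cover h h∈H U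
    ... | h′ , h′∈H , h′-dom , cons =
      insert a (fromMaybe b₀ (h′ a)) g
      , (h′ , h′∈H , insert-⊑ₑ b₀ g⊑ₑh cons covered)
      , ⊑-insert a∉dom
      , dom-insert
      where
      covered : ∀ x → dom g x ⊎ x ≡ a → InSomeEdge A x → dom h′ x
      covered x x∈ x∈e = proj₂ (h′-dom x) (U-covers x x∈ x∈e)

    compact⇒winning : IsCompactStrategy {A = A} {B = B} k H → Elt B →
                      IsWinningStrategy {A = A} {B = B} k (EdgeDownset H)
    compact⇒winning compact@(hom , (h₀ , h₀∈H) , _) b₀ =
        (λ g (h , h∈H , g⊑ₑh) → ⊑ₑ-isProjHom g⊑ₑh (hom h h∈H))
      , (h₀ , h₀ , h₀∈H , ⊑ₑ-refl)
      , EdgeDownset-extend compact b₀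
      , λ { g f (h , h∈H , g⊑ₑh) f⊑g → h , h∈H , ⊑-⊑ₑ-trans f⊑g g⊑ₑh }

  restrict : List (Hyperedge A) → PFun A B → PFun A B
  restrict es h x with ⋃? es x
  ... | yes _ = h x
  ... | no _ = nothing

  restrict-⊑ : restrict es h ⊑ h
  restrict-⊑ {es = es} x b eq with ⋃? es x
  ... | yes _ = eq

  dom-restrict⊆ : dom (restrict es h) ⊆′ ⋃ es
  dom-restrict⊆ {es = es} x x∈dom with ⋃? es x
  ... | yes x∈U = x∈U

  restrict-agrees : ⋃ es x → h x ≡ just b → restrict es h x ≡ just b
  restrict-agrees {es = es} {x = x} x∈U eq with ⋃? es x
  ... | yes _ = eq
  ... | no x∉U = ⊥-elim (x∉U x∈U)

  ∅ : PFun A B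
  ∅ _ = nothing

  CompactPart : ℕ → (PFun A B → Set) → PFun A B → Set
  CompactPart k H h = H h × Σ (KUnion A k) λ U → DomIs h (proj₁ U)

  module _ {k : ℕ} {H : PFun A B → Set} where

    record ExtensionWithin (es : List (Hyperedge A)) (g : PFun A B) (P : Subset A) : Set where
      field
        ext       : PFun A B
        ext∈H     : H ext
        ⊑ext      : g ⊑ ext
        dom-ext⊆  : dom ext ⊆′ ⋃ es
        ext-covers : ∀ x → P x → ⋃ es x → dom ext x
    open ExtensionWithin

    unchanged : H g → dom g ⊆′ ⋃ es → ∀ {P} → (∀ x → P x → ⋃ es x → dom g x) →
                ExtensionWithin es g P
    unchanged {g = g} g∈H g⊆U covers = record
      { ext = g ; ext∈H = g∈H ; ⊑ext = ⊑-refl ; dom-ext⊆ = g⊆U ; ext-covers = covers }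

    -- Adding x ∈ U keeps the domain inside the k-union U, so its weight is ≤ k.
    extendAt : IsWinningStrategy {A = A} {B = B} k H → (U : KUnion A k) →
               H g → dom g ⊆′ ⋃ (proj₁ U) → ∀ x → ExtensionWithin (proj₁ U) g (x ≡_)
    extendAt {g = g} (_ , _ , extend , _) U@(es , _) g∈H g⊆U x with dom? g x | ⋃? es x
    ... | yes x∈dom | _ = unchanged g∈H g⊆U λ { _ refl _ → x∈dom }
    ... | no _ | no x∉U = unchanged g∈H g⊆U λ { _ refl x∈U → ⊥-elim (x∉U x∈U) }
    ... | no x∉dom | yes x∈U
      with extend g g∈H x x∉dom (U , λ y y∈ _ → [ g⊆U y , (λ { refl → x∈U }) ] y∈)
    ...   | g′ , g′∈H , g⊑g′ , g′-dom = record
      { ext = g′ ; ext∈H = g′∈H ; ⊑ext = g⊑g′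
      ; dom-ext⊆ = λ y y∈dom → [ g⊆U y , (λ { refl → x∈U }) ] (proj₁ (g′-dom y) y∈dom)
      ; ext-covers = λ { _ refl _ → proj₂ (g′-dom x) (inj₂ refl) } }

    extendAll : IsWinningStrategy {A = A} {B = B} k H → (U : KUnion A k) →
                H g → dom g ⊆′ ⋃ (proj₁ U) → ∀ xs → ExtensionWithin (proj₁ U) g (_∈ xs)
    extendAll _ U g∈H g⊆U [] = unchanged g∈H g⊆U λ _ ()
    extendAll winning U g∈H g⊆U (x ∷ xs) = record
      { ext = ext E₂ ; ext∈H = ext∈H E₂ ; ⊑ext = ⊑-trans (⊑ext E₁) (⊑ext E₂)
      ; dom-ext⊆ = dom-ext⊆ E₂
      ; ext-covers = λ { _ (here refl) y∈U → ⊑⇒dom⊆ (⊑ext E₂) _ (ext-covers E₁ _ refl y∈U)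
                       ; y (there y∈xs) y∈U → ext-covers E₂ y y∈xs y∈U } }
      where
      E₁ : ExtensionWithin (proj₁ U) _ (x ≡_)
      E₁ = extendAt winning U g∈H g⊆U x
      E₂ : ExtensionWithin (proj₁ U) (ext E₁) (_∈ xs)
      E₂ = extendAll winning U (ext∈H E₁) (dom-ext⊆ E₁) xs

    extendOnto : IsWinningStrategy {A = A} {B = B} k H → (U : KUnion A k) →
                 H g → dom g ⊆′ ⋃ (proj₁ U) →
                 Σ (PFun A B) λ g′ → H g′ × g ⊑ g′ × DomIs g′ (proj₁ U)
    extendOnto winning U g∈H g⊆U =
      ext E , ext∈H E , ⊑ext E , λ x → dom-ext⊆ E x , ext-covers E x (∈-allFin x)
      where
      E : ExtensionWithin (proj₁ U) _ (_∈ allFin _)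
      E = extendAll winning U g∈H g⊆U (allFin _)

    CompactPart-cover : IsWinningStrategy {A = A} {B = B} k H →
      ∀ h → CompactPart k H h → (U : KUnion A k) →
      Σ (PFun A B) λ h′ → CompactPart k H h′ × DomIs h′ (proj₁ U) × Consistent h h′
    CompactPart-cover winning@(_ , _ , _ , closed) h (h∈H , _) U@(es , _)
      with extendOnto winning U (closed h (restrict es h) h∈H (restrict-⊑ {es = es})) dom-restrict⊆
    ... | h′ , h′∈H , r⊑h′ , h′-dom = h′ , (h′∈H , U , h′-dom) , h′-dom , consistent
      where
      consistent : Consistent h h′
      consistent v b b′ hv≡b h′v≡b′ = just-injective (trans (sym h′v≡b) h′v≡b′)
        where
        h′v≡b : h′ v ≡ just b
        h′v≡b = r⊑h′ v b (restrict-agrees {es = es} (proj₁ (h′-dom v) (≡just⇒Is-just h′v≡b′)) hv≡b)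

    winning⇒compact : IsWinningStrategy {A = A} {B = B} k H →
                      IsCompactStrategy {A = A} {B = B} k (CompactPart k H)
    winning⇒compact winning@(hom , (h₀ , h₀∈H) , _ , closed) =
        (λ h (h∈H , _) → hom h h∈H)
      , (∅ , closed h₀ ∅ h₀∈H (λ _ _ ()) , ([] , z≤n) , λ _ → (λ ()) , λ ())
      , (λ h (_ , U , h-dom) → U , h-dom)
      , CompactPart-cover winning

proposition3 : (k : ℕ) → k ≥ 1 → (σ : Signature) → (A B : Structure σ) →
    size A > 0 → size B > 0 →
    (HasWinningStrategy {A = A} {B = B} k → HasCompactStrategy {A = A} {B = B} k) ×
    (HasCompactStrategy {A = A} {B = B} k → HasWinningStrategy {A = A} {B = B} k)
proposition3 k _ σ A B _ B≠∅ =
    (λ (H , winning) → CompactPart A B k H , winning⇒compact A B winning)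
  , (λ (H , compact) → EdgeDownset A B H , compact⇒winning A B compact (fromℕ< B≠∅))
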